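{- Let $q\ge 2$ and $n\ge 2$. The period of a negative orientable sequence of order $n$ over $\mathbb{Z}_q$ is at most \[ \begin{cases} (q^n-q^{n/2})/2 & \text{if $n$ is even},\\ (q^n-q^{(n-1)/2})/2 & \text{if $n$ is odd and $q$ is odd},\\ (q^n-2q^{(n-1)/2})/2 & \text{if $n$ is odd and $q$ is even}. \end{cases} \]
   Context: Sequences are periodic with entries in $\mathbb{Z}_q$. For $S=(s_i)$ write $\mathbf{s}_n(i)=(s_i,\ldots,s_{i+n-1})$; for an $n$-tuple $\mathbf{u}=(u_0,\ldots,u_{n-1})$ let $\mathbf{u}^R=(u_{n-1},\ldots,u_0)$ and $-\mathbf{u}=(-u_0,\ldots,-u_{n-1})$. A periodic sequence of period $m$ is an $n$-window sequence if $\mathbf{s}_n(i)=\mathbf{s}_n(j)$ implies $i\equiv j\pmod m$; it is a negative orientable sequence of order $n$ if also $\mathbf{s}_n(i)\neq-\mathbf{s}_n(j)^R$ for all $i,j$. -}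

module Defs where

open import Data.Nat using (ℕ; zero; suc; _+_; _*_; _∸_; _^_; _≤_; _/_; _%_; NonZero)
open import Data.Empty using (⊥)
open import Data.Fin using (Fin; toℕ; fromℕ<)
open import Data.Nat.DivMod using (m%n<n)
open import Relation.Binary.PropositionalEquality using (_≡_; _≢_)
open import Data.Product using (_×_)

negℤ : {q : ℕ} .{{_ : NonZero q}} → Fin q → Fin q
negℤ {q} x = fromℕ< (m%n<n (q ∸ toℕ x) q)

Seq : ℕ → Set
Seq q = ℕ → Fin q

Periodic : {q : ℕ} → Seq q → ℕ → Set
Periodic s m = ∀ i → s (i + m) ≡ s i

window : {q : ℕ} → Seq q → (n : ℕ) → ℕ → Fin n → Fin q
window s n i j = s (i + toℕ j)

rev : {A : Set} {n : ℕ} → (Fin n → A) → Fin n → A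
rev u j = u (Data.Fin.opposite j)

negT : {q n : ℕ} .{{_ : NonZero q}} → (Fin n → Fin q) → Fin n → Fin q
negT u j = negℤ (u j)

_≐_ : {A : Set} {n : ℕ} → (Fin n → A) → (Fin n → A) → Set
u ≐ v = ∀ j → u j ≡ v j

IsWindowSeq : {q : ℕ} .{{_ : NonZero q}} → (n : ℕ) → Seq q → (m : ℕ) → .{{_ : NonZero m}} → Set
IsWindowSeq n s m = ∀ i j → window s n i ≐ window s n j → i % m ≡ j % m

IsNOS : {q : ℕ} .{{_ : NonZero q}} → (n : ℕ) → Seq q → (m : ℕ) → .{{_ : NonZero m}} → Set
IsNOS n s m =
  Periodic s m × IsWindowSeq n s m ×
  (∀ i j → (window s n i ≐ rev (negT (window s n j))) → ⊥)

-- The bound from the corollary, as the subtracted term c(q,n) so that the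
-- bound reads  period ≤ (q^n - c(q,n)) / 2 , i.e.  2 * period + c(q,n) ≤ q^n.
--   n even          : c = q^(n/2)
--   n odd,  q odd   : c = q^((n-1)/2)
--   n odd,  q even  : c = 2 * q^((n-1)/2)
correction : ℕ → ℕ → ℕ
correction q n with n % 2 | q % 2
... | 0 | _ = q ^ (n / 2)
... | _ | 0 = 2 * q ^ (n / 2)
... | _ | _ = q ^ (n / 2)

{-# OPTIONS --safe #-}
-- The m windows of the sequence, their images under the involution u ↦ −uᴿ
-- and the fixed points of that involution are pairwise distinct n-tuples:
-- windows are distinct by the window property, and orientability keeps every
-- window apart from every image, so in particular neither a window nor an
-- image is fixed.  Hence 2m + #fixed ≤ qⁿ.  A fixed tuple may be chosen freely
-- in its first ⌊n/2⌋ entries; for odd n its middle entry z must satisfy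
-- z = −z, which allows z = 0 and, when q is even, also z = q/2.
module Submission where

open import Defs
open import Data.Nat.Base
  using (ℕ; zero; suc; _+_; _*_; _∸_; _^_; _%_; _/_; _≤_; _<_; z≤n; s≤s; NonZero)
open import Data.Nat.Properties
  using (+-identityʳ; *-comm; +-cancelˡ-≤; +-mono-≤; m≤n+m; m≤m+n; m+n∸m≡n; m+[n∸m]≡n; m<m+n;
         m∸[m∸n]≡n; ∸-monoʳ-<; <⇒≢; ≤-trans; ≤-reflexive; <⇒≤; n≮n; _<?_)
open import Data.Nat.DivMod using (m≡m%n+[m/n]*n; n%n≡0; m%n<n; m<n⇒m%n≡m)
open import Data.Fin.Base as Fin
  using (Fin; toℕ; fromℕ<; inject≤; splitAt; join; opposite; combine; funToFin; finToFun)
open import Data.Fin.Properties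
  using (toℕ-fromℕ<; toℕ-injective; toℕ<n; toℕ-inject≤; join-splitAt; opposite-prop;
         opposite-involutive; injective⇒≤; finToFun-funToFin; funToFin-finToFin)
open import Data.Vec.Functional using (Vector; _++_; map)
open import Data.Vec.Functional.Relation.Unary.All using (All)
open import Data.Vec.Functional.Relation.Unary.All.Properties using (++⁺)
open import Data.Sum.Base using (inj₁; inj₂; [_,_]′)
open import Data.Product.Base using (_×_; _,_; Σ-syntax)
open import Data.Empty using (⊥-elim)
open import Function.Base using (_∘_)
open import Function.Definitions using (Injective; Congruent)
open import Algebra.Definitions using (Involutive)
open import Relation.Nullary using (¬_; yes; no)
open import Relation.Binary.Bundles using (Setoid)
open import Relation.Binary.PropositionalEquality
open ≡-Reasoning

splitAt-injective : ∀ m {n} → Injective _≡_ _≡_ (splitAt m {n})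
splitAt-injective m {n} {i} {j} eq = begin
  i                       ≡⟨ join-splitAt m n i ⟨
  join m n (splitAt m i)  ≡⟨ cong (join m n) eq ⟩
  join m n (splitAt m j)  ≡⟨ join-splitAt m n j ⟩
  j                       ∎

module _ {a ℓ} (S : Setoid a ℓ) where
  open Setoid S using (Carrier; _≈_) renaming (sym to ≈-sym; trans to ≈-trans)

  [,]-injective : {B C : Set} {f : B → Carrier} {g : C → Carrier} →
                  Injective _≡_ _≈_ f → Injective _≡_ _≈_ g → (∀ x y → ¬ f x ≈ g y) →
                  Injective _≡_ _≈_ [ f , g ]′
  [,]-injective f-inj g-inj apart {inj₁ x} {inj₁ y} eq = cong inj₁ (f-inj eq)
  [,]-injective f-inj g-inj apart {inj₁ x} {inj₂ y} eq = ⊥-elim (apart x y eq)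
  [,]-injective f-inj g-inj apart {inj₂ x} {inj₁ y} eq = ⊥-elim (apart y x (≈-sym eq))
  [,]-injective f-inj g-inj apart {inj₂ x} {inj₂ y} eq = cong inj₂ (g-inj eq)

  ++-injective : ∀ {m n} {xs : Vector Carrier m} {ys : Vector Carrier n} →
                 Injective _≡_ _≈_ xs → Injective _≡_ _≈_ ys → (∀ i j → ¬ xs i ≈ ys j) →
                 Injective _≡_ _≈_ (xs ++ ys)
  ++-injective {m} xs-inj ys-inj apart eq =
    splitAt-injective m ([,]-injective xs-inj ys-inj apart eq)

  module Involution (φ : Carrier → Carrier) (φ-cong : Congruent _≈_ _≈_ φ)
               (φ-involutive : Involutive _≈_ φ) where

    φ-injective : Injective _≈_ _≈_ φ
    φ-injective {x} {y} eq = ≈-trans (≈-sym (φ-involutive x)) (≈-trans (φ-cong eq) (φ-involutive y))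

    ≉-fixed : ∀ {x y} → φ y ≈ y → ¬ x ≈ φ x → ¬ x ≈ y
    ≉-fixed fixed x≉φx x≈y = x≉φx (≈-trans x≈y (≈-trans (≈-sym fixed) (φ-cong (≈-sym x≈y))))

    flips-fixed-injective : ∀ {m c} {W : Vector Carrier m} {e : Vector Carrier c} →
                            Injective _≡_ _≈_ W → (∀ i j → ¬ W i ≈ φ (W j)) →
                            Injective _≡_ _≈_ e → (∀ x → φ (e x) ≈ e x) →
                            Injective _≡_ _≈_ ((W ++ map φ W) ++ e)
    flips-fixed-injective {W = W} {e} W-inj W≉φW e-inj e-fixed =
      ++-injective
        (++-injective W-inj (W-inj ∘ φ-injective) W≉φW) e-inj (apart ∘ splitAt _)
      where
      apart : ∀ i x → ¬ [ W , map φ W ]′ i ≈ e x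
      apart (inj₁ i) x = ≉-fixed (e-fixed x) (W≉φW i i)
      apart (inj₂ i) x = ≉-fixed (e-fixed x) (W≉φW i i ∘ φ-injective)

funToFin-cong : ∀ {m n} {f g : Fin m → Fin n} → f ≗ g → funToFin f ≡ funToFin g
funToFin-cong {zero}  f≗g = refl
funToFin-cong {suc m} f≗g = cong₂ combine (f≗g Fin.zero) (funToFin-cong (f≗g ∘ Fin.suc))

funToFin-injective : ∀ {m n} → Injective _≗_ _≡_ (funToFin {m} {n})
funToFin-injective {x = f} {y = g} eq j = begin
  f j                      ≡⟨ finToFun-funToFin f j ⟨
  finToFun (funToFin f) j  ≡⟨ cong (λ x → finToFun x j) eq ⟩
  finToFun (funToFin g) j  ≡⟨ finToFun-funToFin g j ⟩
  g j                      ∎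

finToFun-injective : ∀ {m n} → Injective _≡_ _≗_ (finToFun {m} {n})
finToFun-injective {m} {n} {x} {y} eq = begin
  x                             ≡⟨ funToFin-finToFin {n} {m} x ⟨
  funToFin (finToFun {m} {n} x) ≡⟨ funToFin-cong eq ⟩
  funToFin (finToFun {m} {n} y) ≡⟨ funToFin-finToFin {n} {m} y ⟩
  y                             ∎

Tuple : ℕ → ℕ → Set
Tuple q n = Fin n → Fin q

tuples-bound : ∀ {q n k} {ts : Vector (Tuple q n) k} → Injective _≡_ _≐_ ts → k ≤ q ^ n
tuples-bound ts-inj = injective⇒≤ (ts-inj ∘ funToFin-injective)

module _ {q : ℕ} .{{_ : NonZero q}} where

  toℕ-negℤ : (x : Fin q) → toℕ (negℤ x) ≡ (q ∸ toℕ x) % q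
  toℕ-negℤ x = toℕ-fromℕ< _

  ∸-%-involutive : ∀ {t} → t < q → (q ∸ (q ∸ t) % q) % q ≡ t
  ∸-%-involutive {zero} _ = begin
    (q ∸ q % q) % q  ≡⟨ cong (λ r → (q ∸ r) % q) (n%n≡0 q) ⟩
    q % q            ≡⟨ n%n≡0 q ⟩
    0                ∎
  ∸-%-involutive {suc t} 1+t<q = begin
    (q ∸ (q ∸ suc t) % q) % q  ≡⟨ cong (λ r → (q ∸ r) % q) (m<n⇒m%n≡m q∸[1+t]<q) ⟩
    (q ∸ (q ∸ suc t)) % q      ≡⟨ cong (_% q) (m∸[m∸n]≡n (<⇒≤ 1+t<q)) ⟩
    suc t % q                  ≡⟨ m<n⇒m%n≡m 1+t<q ⟩
    suc t                      ∎
    where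
    q∸[1+t]<q : q ∸ suc t < q
    q∸[1+t]<q = ∸-monoʳ-< {q} {suc t} {0} (s≤s z≤n) (<⇒≤ 1+t<q)

  negℤ-involutive : Involutive _≡_ (negℤ {q})
  negℤ-involutive x = toℕ-injective (begin
    toℕ (negℤ (negℤ x))              ≡⟨ toℕ-negℤ (negℤ x) ⟩
    (q ∸ toℕ (negℤ x)) % q           ≡⟨ cong (λ r → (q ∸ r) % q) (toℕ-negℤ x) ⟩
    (q ∸ (q ∸ toℕ x) % q) % q        ≡⟨ ∸-%-involutive (toℕ<n x) ⟩
    toℕ x                            ∎)

  negℤ-half : ∀ {h} (h<q : h < q) → q ≡ h + h → negℤ (fromℕ< h<q) ≡ fromℕ< h<q
  negℤ-half {h} h<q q≡h+h = toℕ-injective (begin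
    toℕ (negℤ (fromℕ< h<q))       ≡⟨ toℕ-negℤ (fromℕ< h<q) ⟩
    (q ∸ toℕ (fromℕ< h<q)) % q    ≡⟨ cong (λ r → (q ∸ r) % q) (toℕ-fromℕ< h<q) ⟩
    (q ∸ h) % q                   ≡⟨ cong (λ p → (p ∸ h) % q) q≡h+h ⟩
    (h + h ∸ h) % q               ≡⟨ cong (_% q) (m+n∸m≡n h h) ⟩
    h % q                         ≡⟨ m<n⇒m%n≡m h<q ⟩
    h                             ≡⟨ toℕ-fromℕ< h<q ⟨
    toℕ (fromℕ< h<q)              ∎)

negℤ-zero : ∀ {q} → negℤ {suc q} Fin.zero ≡ Fin.zero
negℤ-zero {q} = toℕ-injective (trans (toℕ-negℤ Fin.zero) (n%n≡0 (suc q)))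

module Mirror {A : Set} (ν : A → A) (ν-involutive : Involutive _≡_ ν) {n : ℕ} (k : ℕ) where

  mirrorAt : (Fin k → A) → A → ℕ → ℕ → A
  mirrorAt u z a b with a <? k | b <? k
  ... | yes a<k | _       = u (fromℕ< a<k)
  ... | no _    | yes b<k = ν (u (fromℕ< b<k))
  ... | no _    | no _    = z

  -- (u₀, …, u_{k−1}, z, …, z, ν u_{k−1}, …, ν u₀): position j is read off from
  -- its distances toℕ j and toℕ (opposite j) to the two ends.
  mirror : (Fin k → A) → A → Vector A n
  mirror u z j = mirrorAt u z (toℕ j) (toℕ (opposite j))

  mirrorAt-swap : ∀ {u z a b} → ν z ≡ z → ¬ (a < k × b < k) →
                  ν (mirrorAt u z b a) ≡ mirrorAt u z a b
  mirrorAt-swap {a = a} {b} νz≡z not-both with a <? k | b <? k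
  ... | yes a<k | yes b<k = ⊥-elim (not-both (a<k , b<k))
  ... | yes _   | no _    = ν-involutive _
  ... | no _    | yes _   = refl
  ... | no _    | no _    = νz≡z

  mirrorAt-left : ∀ {u z a b} (i : Fin k) → a ≡ toℕ i → mirrorAt u z a b ≡ u i
  mirrorAt-left {u} {a = a} i a≡i with a <? k
  ... | yes a<k = cong u (toℕ-injective (trans (toℕ-fromℕ< a<k) a≡i))
  ... | no a≮k  = ⊥-elim (a≮k (subst (_< k) (sym a≡i) (toℕ<n i)))

  mirrorAt-centre : ∀ {u z a b} → ¬ a < k → ¬ b < k → mirrorAt u z a b ≡ z
  mirrorAt-centre {a = a} {b} a≮k b≮k with a <? k | b <? k
  ... | yes a<k | _       = ⊥-elim (a≮k a<k)
  ... | no _    | yes b<k = ⊥-elim (b≮k b<k)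
  ... | no _    | no _    = refl

  suc-toℕ+toℕ-opposite : (j : Fin n) → suc (toℕ j) + toℕ (opposite j) ≡ n
  suc-toℕ+toℕ-opposite j = trans (cong (suc (toℕ j) +_) (opposite-prop j)) (m+[n∸m]≡n (toℕ<n j))

  not-both-within : k + k ≤ n → (j : Fin n) → ¬ (toℕ j < k × toℕ (opposite j) < k)
  not-both-within k+k≤n j (a<k , b<k) =
    n≮n b (+-cancelˡ-≤ (suc (toℕ j)) (suc b) b
      (≤-trans (+-mono-≤ a<k b<k) (≤-trans k+k≤n (≤-reflexive (sym (suc-toℕ+toℕ-opposite j))))))
    where b = toℕ (opposite j)

  mirror-reflect : ∀ {u z} → k + k ≤ n → ν z ≡ z → ∀ j → ν (mirror u z (opposite j)) ≡ mirror u z j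
  mirror-reflect {u} {z} k+k≤n νz≡z j = begin
    ν (mirrorAt u z (toℕ (opposite j)) (toℕ (opposite (opposite j))))
      ≡⟨ cong (λ i → ν (mirrorAt u z (toℕ (opposite j)) (toℕ i))) (opposite-involutive j) ⟩
    ν (mirrorAt u z (toℕ (opposite j)) (toℕ j))
      ≡⟨ mirrorAt-swap νz≡z (not-both-within k+k≤n j) ⟩
    mirrorAt u z (toℕ j) (toℕ (opposite j))
      ∎

  mirror-injectiveˡ : ∀ {u u′ z z′} → k ≤ n → mirror u z ≐ mirror u′ z′ → u ≗ u′
  mirror-injectiveˡ {u} {u′} {z} {z′} k≤n eq i = begin
    u i                ≡⟨ mirrorAt-left i (toℕ-inject≤ i k≤n) ⟨
    mirror u z j       ≡⟨ eq j ⟩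
    mirror u′ z′ j     ≡⟨ mirrorAt-left i (toℕ-inject≤ i k≤n) ⟩
    u′ i               ∎
    where j = inject≤ i k≤n

  mirror-injective-centre : ∀ {u u′ z z′} → n ≡ suc (k + k) → mirror u z ≐ mirror u′ z′ → z ≡ z′
  mirror-injective-centre {u} {u′} {z} {z′} n≡1+2k eq = begin
    z                ≡⟨ mirrorAt-centre (≮k (toℕ-fromℕ< k<n)) (≮k opposite-c≡k) ⟨
    mirror u z c     ≡⟨ eq c ⟩
    mirror u′ z′ c   ≡⟨ mirrorAt-centre (≮k (toℕ-fromℕ< k<n)) (≮k opposite-c≡k) ⟩
    z′               ∎
    where
    k<n : k < n
    k<n = subst (k <_) (sym n≡1+2k) (s≤s (m≤m+n k k))
    c = fromℕ< k<n
    opposite-c≡k : toℕ (opposite c) ≡ k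
    opposite-c≡k = begin
      toℕ (opposite c)      ≡⟨ opposite-prop c ⟩
      n ∸ suc (toℕ c)       ≡⟨ cong₂ (λ p r → p ∸ suc r) n≡1+2k (toℕ-fromℕ< k<n) ⟩
      suc (k + k) ∸ suc k   ≡⟨ m+n∸m≡n k k ⟩
      k                     ∎
    ≮k : ∀ {b} → b ≡ k → ¬ b < k
    ≮k refl = n≮n k

module _ {q n : ℕ} .{{_ : NonZero q}} where

  negRev : Tuple q n → Tuple q n
  negRev u = rev (negT u)

  negRev-cong : Congruent _≐_ _≐_ negRev
  negRev-cong u≐v j = cong negℤ (u≐v (opposite j))

  negRev-involutive : Involutive _≐_ negRev
  negRev-involutive u j = trans (negℤ-involutive _) (cong u (opposite-involutive j))

  Negasymmetric : Tuple q n → Set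
  Negasymmetric u = negRev u ≐ u

  NegasymmetricFamily : ℕ → Set
  NegasymmetricFamily c =
    Σ[ e ∈ Vector (Tuple q n) c ] Injective _≡_ _≐_ e × All Negasymmetric e

  module _ (k : ℕ) where
    open Mirror negℤ negℤ-involutive {n} k

    mirrors : Fin q → Vector (Tuple q n) (q ^ k)
    mirrors z x = mirror (finToFun x) z

    mirrors-injective : ∀ {z} → k ≤ n → Injective _≡_ _≐_ (mirrors z)
    mirrors-injective k≤n = finToFun-injective ∘ mirror-injectiveˡ k≤n

    mirrors-negasymmetric : ∀ {z} → k + k ≤ n → negℤ z ≡ z → All Negasymmetric (mirrors z)
    mirrors-negasymmetric k+k≤n negz≡z x = mirror-reflect k+k≤n negz≡z

    mirrors-family : ∀ {z} → k + k ≤ n → negℤ z ≡ z → NegasymmetricFamily (q ^ k)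
    mirrors-family {z} k+k≤n negz≡z =
      mirrors z ,
      mirrors-injective (≤-trans (m≤m+n k k) k+k≤n) ,
      mirrors-negasymmetric k+k≤n negz≡z

    two-centres-family : ∀ {z₀ z₁} → n ≡ suc (k + k) → z₀ ≢ z₁ →
                         negℤ z₀ ≡ z₀ → negℤ z₁ ≡ z₁ → NegasymmetricFamily (q ^ k + q ^ k)
    two-centres-family {z₀} {z₁} n≡1+2k z₀≢z₁ negz₀≡z₀ negz₁≡z₁ =
      mirrors z₀ ++ mirrors z₁ ,
      ++-injective (Fin n →-setoid Fin q) (mirrors-injective k≤n) (mirrors-injective k≤n)
        (λ _ _ → z₀≢z₁ ∘ mirror-injective-centre n≡1+2k) ,
      ++⁺ Negasymmetric (mirrors-negasymmetric k+k≤n negz₀≡z₀) (mirrors-negasymmetric k+k≤n negz₁≡z₁)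
      where
      k+k≤n : k + k ≤ n
      k+k≤n = subst (k + k ≤_) (sym n≡1+2k) (m≤n+m (k + k) 1)
      k≤n : k ≤ n
      k≤n = ≤-trans (m≤m+n k k) k+k≤n

n≡n%2+[n/2+n/2] : ∀ n → n ≡ n % 2 + (n / 2 + n / 2)
n≡n%2+[n/2+n/2] n = begin
  n                        ≡⟨ m≡m%n+[m/n]*n n 2 ⟩
  n % 2 + n / 2 * 2        ≡⟨ cong (n % 2 +_) (*-comm (n / 2) 2) ⟩
  n % 2 + 2 * (n / 2)      ≡⟨ cong (λ h → n % 2 + (n / 2 + h)) (+-identityʳ (n / 2)) ⟩
  n % 2 + (n / 2 + n / 2)  ∎

n/2+n/2≤n : ∀ n → n / 2 + n / 2 ≤ n
n/2+n/2≤n n = subst (n / 2 + n / 2 ≤_) (sym (n≡n%2+[n/2+n/2] n)) (m≤n+m _ (n % 2))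

even⇒nonzero-negℤ-fixed-point : ∀ {q} → suc q % 2 ≡ 0 → Σ[ z ∈ Fin (suc q) ] Fin.zero ≢ z × negℤ z ≡ z
even⇒nonzero-negℤ-fixed-point {q} q%2≡0 = fromℕ< h<q , zero≢h , negℤ-half h<q q≡h+h
  where
  h = suc q / 2
  q≡h+h : suc q ≡ h + h
  q≡h+h = trans (n≡n%2+[n/2+n/2] (suc q)) (cong (_+ (h + h)) q%2≡0)
  0<h : 0 < h
  0<h with h | q≡h+h
  ... | zero  | ()
  ... | suc _ | _ = s≤s z≤n
  h<q : h < suc q
  h<q = subst (h <_) (sym q≡h+h) (m<m+n h 0<h)
  zero≢h : Fin.zero ≢ fromℕ< h<q
  zero≢h eq = <⇒≢ 0<h (trans (cong toℕ eq) (toℕ-fromℕ< h<q))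

negasymmetric-family : ∀ q n → NegasymmetricFamily {suc q} {n} (correction (suc q) n)
negasymmetric-family q n with n % 2 in n%2 | suc q % 2 in q%2
... | 0           | _     = mirrors-family (n / 2) (n/2+n/2≤n n) negℤ-zero
... | suc _       | suc _ = mirrors-family (n / 2) (n/2+n/2≤n n) negℤ-zero
... | suc (suc _) | 0 with s≤s (s≤s ()) ← subst (_< 2) n%2 (m%n<n n 2)
... | 1           | 0 with even⇒nonzero-negℤ-fixed-point q%2
...   | z , zero≢z , negz≡z =
  subst NegasymmetricFamily (cong (suc q ^ k +_) (sym (+-identityʳ (suc q ^ k))))
    (two-centres-family k n≡1+2k zero≢z negℤ-zero negz≡z)
  where
  k = n / 2
  n≡1+2k : n ≡ suc (k + k)
  n≡1+2k = trans (n≡n%2+[n/2+n/2] n) (cong (_+ (k + k)) n%2)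

windows : ∀ {q} → Seq q → (n m : ℕ) → Vector (Tuple q n) m
windows s n m i = window s n (toℕ i)

windows-injective : ∀ {q n m} {s : Seq q} .{{_ : NonZero q}} .{{_ : NonZero m}} →
                    IsWindowSeq n s m → Injective _≡_ _≐_ (windows s n m)
windows-injective {m = m} distinct {i} {j} eq = toℕ-injective (begin
  toℕ i      ≡⟨ m<n⇒m%n≡m (toℕ<n i) ⟨
  toℕ i % m  ≡⟨ distinct (toℕ i) (toℕ j) eq ⟩
  toℕ j % m  ≡⟨ m<n⇒m%n≡m (toℕ<n j) ⟩
  toℕ j      ∎)

nos-bound : ∀ {q n m c} {s : Seq q} .{{_ : NonZero q}} .{{_ : NonZero m}} →
            IsNOS n s m → NegasymmetricFamily {q} {n} c → 2 * m + c ≤ q ^ n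
nos-bound {q} {n} {m} {c} {s} (_ , distinct , orientable) (e , e-injective , e-negasymmetric) =
  subst (λ m′ → m + m′ + c ≤ q ^ n) (sym (+-identityʳ m))
    (tuples-bound (flips-fixed-injective (windows-injective {s = s} distinct)
                    (λ i j → orientable (toℕ i) (toℕ j)) e-injective e-negasymmetric))
  where open Involution (Fin n →-setoid Fin q) negRev negRev-cong negRev-involutive

corollary1 : (q n : ℕ) → 2 ≤ q → 2 ≤ n → .{{_ : NonZero q}} →
    (s : Seq q) (m : ℕ) .{{_ : NonZero m}} →
    IsNOS n s m → 2 * m + correction q n ≤ q ^ n
corollary1 zero    n ()
corollary1 (suc q) n _ _ s m nos = nos-bound nos (negasymmetric-family q n)
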